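{- Let $\nu\geq1$. Then the following sets $\mathcal{S}$ are $(\nu,0)$-spreads in $\mathbb{F}_q^{2\nu}$ (i.e. sets of pairwise disjoint maximal totally isotropic flats partitioning $\mathbb{F}_q^{2\nu}$). (i) (Type I) $\mathcal{S}=\{P+x: x\in\mathbb{F}_q^{2\nu}\}$ for a maximal totally isotropic subspace $P$. (ii) (Type II) Suppose $\nu\geq2$, $Q$ is a subspace of type $(\nu+1,2)$ in $\mathbb{F}_q^{2\nu}$, and $P_1,P_2$ are two distinct maximal totally isotropic subspaces contained in $Q$. Then $\mathcal{S}=\{P_1+y_1: y_1\in Q\}\cup\{P_2+y_2: y_2\in\mathbb{F}_q^{2\nu}\setminus Q\}$.
   Context: Let $e=1$, $1/2$ or $0$, and let $\mathbb{F}_q^{2\nu}$ be the $2\nu$-dimensional symplectic ($e=1$), unitary ($e=1/2$, $q$ a square) or orthogonal ($e=0$, $q$ odd, Witt index $\nu$) space over $\mathbb{F}_q$. A maximal totally isotropic flat ($(\nu,0)$-flat) is a coset $P+x$ of a $\nu$-dimensional totally isotropic subspace $P$. A subspace of type $(\nu+1,2)$ is a $(\nu+1)$-dimensional subspace such that the restriction of the form has rank $2$ (in the orthogonal case: is cogredient to $\mathrm{diag}(S_2,0^{(\nu-1)})$ with $S_2=\begin{pmatrix}0&1\\1&0\end{pmatrix}$); such a subspace contains exactly $q^e+1\ge 2$ maximal totally isotropic subspaces. -}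

module Defs where

open import Level using (Level; _⊔_) renaming (suc to lsuc)
open import Data.Nat using (ℕ; zero; suc; _%_) renaming (_+_ to _+ℕ_; _*_ to _*ℕ_)
open import Data.Fin using (Fin; _↑ˡ_; _↑ʳ_)
import Data.Fin as Fin
open import Data.Product using (Σ; ∃; _×_; _,_)
open import Data.Sum using (_⊎_)
open import Algebra.Bundles using (CommutativeRing)
open import Function.Bundles using (Inverse)
open import Relation.Binary.PropositionalEquality as ≡ using (_≡_)
open import Relation.Nullary using (¬_)

record FiniteField c ℓ : Set (lsuc (c ⊔ ℓ)) where
  field
    commRing : CommutativeRing c ℓ
  open CommutativeRing commRing public
  field
    1≉0     : ¬ (1# ≈ 0#)
    inverse : ∀ x → ¬ (x ≈ 0#) → ∃ λ y → x * y ≈ 1#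
    q       : ℕ
    enum    : Inverse (≡.setoid (Fin q)) setoid

-- The three geometries (e = 1, 1/2, 0), with their side conditions on q.
--  * symplectic  (e = 1)
--  * unitary     (e = 1/2): q = r * r, involution a ↦ a ^ r
--  * orthogonal  (e = 0)  : q odd

data Geom (q : ℕ) : Set where
  symplectic : Geom q
  unitary    : (r : ℕ) → q ≡ r *ℕ r → Geom q
  orthogonal : q % 2 ≡ 1 → Geom q

-- Everything below lives in F_q^{2ν}, vectors indexed by Fin (ν + ν):
-- coordinates i ↑ˡ ν are the first ν, ν ↑ʳ i the last ν.

module Geometry {c ℓ} (𝔽 : FiniteField c ℓ) (g : Geom (FiniteField.q 𝔽)) (ν : ℕ) where
  open FiniteField 𝔽

  Vec : ℕ → Set c
  Vec n = Fin n → Carrier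

  sum : ∀ {n} → (Fin n → Carrier) → Carrier
  sum {zero}  f = 0#
  sum {suc n} f = f Fin.zero + sum (λ i → f (Fin.suc i))

  lin : ∀ {k n} → (Fin k → Vec n) → Vec k → Vec n
  lin M a j = sum (λ i → a i * M i j)

  _≋_ : ∀ {n} → Vec n → Vec n → Set ℓ
  x ≋ y = ∀ j → x j ≈ y j

  _⊕_ : ∀ {n} → Vec n → Vec n → Vec n
  (x ⊕ y) j = x j + y j

  LinIndep : ∀ {k n} → (Fin k → Vec n) → Set (c ⊔ ℓ)
  LinIndep M = ∀ a → lin M a ≋ (λ _ → 0#) → ∀ i → a i ≈ 0#

  InSpan : ∀ {k n} → (Fin k → Vec n) → Vec n → Set (c ⊔ ℓ)
  InSpan M v = ∃ λ a → v ≋ lin M a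

  HasRank : ∀ {k n} → (Fin k → Vec n) → ℕ → Set (c ⊔ ℓ)
  HasRank M r =
    (∃ λ (W : Fin r → Vec _) → LinIndep W × (∀ i → InSpan M (W i)))
    × (∀ (W : Fin (suc r) → Vec _) → (∀ i → InSpan M (W i)) → ¬ LinIndep W)

  _·_ : ∀ {m} → (Fin m → Vec m) → (Fin m → Vec m) → Fin m → Vec m
  (A · B) i j = sum (λ k → A i k * B k j)

  _ᵀ : ∀ {m} → (Fin m → Vec m) → Fin m → Vec m
  (A ᵀ) i j = A j i

  I : ∀ {m} → Fin m → Vec m
  I Fin.zero    Fin.zero    = 1#
  I Fin.zero    (Fin.suc j) = 0#
  I (Fin.suc i) Fin.zero    = 0#
  I (Fin.suc i) (Fin.suc j) = I i j

  S₂⊕0 : ∀ {m} → Fin m → Vec m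
  S₂⊕0 Fin.zero                (Fin.suc Fin.zero) = 1#
  S₂⊕0 (Fin.suc Fin.zero)      Fin.zero           = 1#
  S₂⊕0 _                       _                  = 0#

  _≋ₘ_ : ∀ {m} → (Fin m → Vec m) → (Fin m → Vec m) → Set ℓ
  A ≋ₘ B = ∀ i j → A i j ≈ B i j

  Cogredient : ∀ {m} → (Fin m → Vec m) → (Fin m → Vec m) → Set (c ⊔ ℓ)
  Cogredient G H = ∃ λ A → ∃ λ B →
    ((A · B) ≋ₘ I) × ((B · A) ≋ₘ I) × (((A · G) · (A ᵀ)) ≋ₘ H)

  V : Set c
  V = Vec (ν +ℕ ν)

  pow : Carrier → ℕ → Carrier
  pow a zero    = 1#
  pow a (suc n) = a * pow a n

  conjG : Geom q → Carrier → Carrier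
  conjG (unitary r _) a = pow a r
  conjG _             a = a

  conj : Carrier → Carrier
  conj = conjG g

  -- x M ȳᵀ with M = K = [[0,I],[-I,0]] (symplectic),
  -- H = [[0,I],[I,0]] (unitary), S = [[0,I],[I,0]] (orthogonal)
  formG : Geom q → V → V → Carrier
  formG symplectic     x y = sum (λ i → x (i ↑ˡ ν) * y (ν ↑ʳ i) - x (ν ↑ʳ i) * y (i ↑ˡ ν))
  formG (unitary _ _)  x y = sum (λ i → x (i ↑ˡ ν) * conj (y (ν ↑ʳ i)) + x (ν ↑ʳ i) * conj (y (i ↑ˡ ν)))
  formG (orthogonal _) x y = sum (λ i → x (i ↑ˡ ν) * y (ν ↑ʳ i) + x (ν ↑ʳ i) * y (i ↑ˡ ν))

  form : V → V → Carrier
  form = formG g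

  -- a subspace of dimension k is given by a k×2ν matrix of rank k
  -- (k linearly independent rows); it is the row space.
  Matrix : ℕ → Set c
  Matrix k = Fin k → V

  Gram : ∀ {k} → Matrix k → Fin k → Vec k
  Gram M i j = form (M i) (M j)

  MaxTI : Matrix ν → Set (c ⊔ ℓ)
  MaxTI P = LinIndep P × (∀ i j → Gram P i j ≈ 0#)

  Type-ν+1,2 : Matrix (suc ν) → Set (c ⊔ ℓ)
  Type-ν+1,2 Q = LinIndep Q × GramCond g
    where
      GramCond : Geom q → Set (c ⊔ ℓ)
      GramCond (orthogonal _) = Cogredient (Gram Q) S₂⊕0
      GramCond _              = HasRank (Gram Q) 2

  Subset : Set (lsuc (c ⊔ ℓ))
  Subset = V → Set (c ⊔ ℓ)

  _≐_ : Subset → Subset → Set (c ⊔ ℓ)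
  A ≐ B = ∀ v → (A v → B v) × (B v → A v)

  Span : ∀ {k} → Matrix k → Subset
  Span M = InSpan M

  _⊆ₛ_ : ∀ {k m} → Matrix k → Matrix m → Set (c ⊔ ℓ)
  P ⊆ₛ Q = ∀ v → Span P v → Span Q v

  Coset : ∀ {k} → Matrix k → V → Subset
  Coset P x v = ∃ λ a → v ≋ (lin P a ⊕ x)

  Flat-ν,0 : Subset → Set (c ⊔ ℓ)
  Flat-ν,0 F = ∃ λ (P : Matrix ν) → ∃ λ x → MaxTI P × (F ≐ Coset P x)

  Family : Set (lsuc (c ⊔ ℓ))
  Family = Subset → Set (c ⊔ ℓ)

  IsSpread : Family → Set (lsuc (c ⊔ ℓ))
  IsSpread 𝒮 =
    (∀ F → 𝒮 F → Flat-ν,0 F)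
    × (∀ v → ∃ λ F → 𝒮 F × F v)
    × (∀ F G v → 𝒮 F → 𝒮 G → F v → G v → F ≐ G)

  TypeI : Matrix ν → Family
  TypeI P F = ∃ λ x → F ≐ Coset P x

  TypeII : Matrix (suc ν) → Matrix ν → Matrix ν → Family
  TypeII Q P₁ P₂ F =
    (∃ λ y → Span Q y × (F ≐ Coset P₁ y))
    ⊎ (∃ λ y → ¬ Span Q y × (F ≐ Coset P₂ y))

-- The members of a Type I or Type II family are cosets of maximal totally
-- isotropic subspaces, so they are (ν,0)-flats. Cosets of one subspace P
-- partition the space: two cosets of P through a common vector coincide.
-- For Type II, a coset of P₁ ⊆ Q through a point of Q lies inside Q, while
-- a coset of P₂ ⊆ Q through a point outside Q misses Q, so cosets of the
-- two kinds never meet. Every vector lies in a member of the family since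
-- membership in Q is decidable over the finite field.
module Submission where

open import Defs
open import Data.Nat using (ℕ; _≤_; suc; zero)
open import Data.Product using (_×_; _,_; ∃; proj₁; proj₂)
open import Data.Sum using (inj₁; inj₂)
open import Data.Empty using (⊥-elim)
open import Data.Fin using (Fin)
import Data.Fin as Fin
open import Data.Fin.Properties using (any?; all?; _≟_)
open import Data.Vec.Functional using (tail; _∷_)
open import Function.Base using (_∘_)
open import Function.Bundles using (Inverse)
import Relation.Binary.PropositionalEquality as ≡
open import Relation.Nullary using (¬_; Dec; yes; no)
open import Relation.Nullary.Decidable using (map′)
import Relation.Binary.Reasoning.Setoid as SetoidReasoning
import Algebra.Properties.Group as GroupProperties
import Algebra.Properties.CommutativeSemigroup as CommutativeSemigroupProperties

module _ {c ℓ} (𝔽 : FiniteField c ℓ) (g : Geom (FiniteField.q 𝔽)) (ν : ℕ) where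
  open FiniteField 𝔽
  open Geometry 𝔽 g ν
  open SetoidReasoning setoid
  open GroupProperties +-group using (\\-leftDividesˡ; \\-leftDividesʳ; y≈x\\z; inverseʳ-unique)
  open CommutativeSemigroupProperties +-commutativeSemigroup using (interchange)

  lin-cong : ∀ {k n} (M : Fin k → Vec n) {a b : Vec k} → (∀ i → a i ≈ b i) → lin M a ≋ lin M b
  lin-cong {zero}  M a≈b j = refl
  lin-cong {suc k} M a≈b j = +-cong (*-congʳ (a≈b Fin.zero)) (lin-cong (tail M) (a≈b ∘ Fin.suc) j)

  lin-zero : ∀ {k n} (M : Fin k → Vec n) → lin M (λ _ → 0#) ≋ (λ _ → 0#)
  lin-zero {zero}  M j = refl
  lin-zero {suc k} M j = trans (+-cong (zeroˡ _) (lin-zero (tail M) j)) (+-identityˡ 0#)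

  lin-+ : ∀ {k n} (M : Fin k → Vec n) (a b : Vec k) → lin M (λ i → a i + b i) ≋ (lin M a ⊕ lin M b)
  lin-+ {zero}  M a b j = sym (+-identityˡ 0#)
  lin-+ {suc k} M a b j = begin
    (a₀ + b₀) * M₀ + lin (tail M) (λ i → a′ i + b′ i) j
      ≈⟨ +-cong (distribʳ M₀ a₀ b₀) (lin-+ (tail M) a′ b′ j) ⟩
    (a₀ * M₀ + b₀ * M₀) + (lin (tail M) a′ j + lin (tail M) b′ j)
      ≈⟨ interchange _ _ _ _ ⟩
    (a₀ * M₀ + lin (tail M) a′ j) + (b₀ * M₀ + lin (tail M) b′ j) ∎
    where
    a₀ = a Fin.zero; b₀ = b Fin.zero; a′ = tail a; b′ = tail b; M₀ = M Fin.zero j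

  lin-neg : ∀ {k n} (M : Fin k → Vec n) (a : Vec k) → lin M (λ i → - a i) ≋ (λ j → - lin M a j)
  lin-neg M a j = inverseʳ-unique (lin M a j) _ (begin
    lin M a j + lin M (λ i → - a i) j ≈⟨ lin-+ M a _ j ⟨
    lin M (λ i → a i + - a i) j      ≈⟨ lin-cong M (λ i → -‿inverseʳ (a i)) j ⟩
    lin M (λ _ → 0#) j               ≈⟨ lin-zero M j ⟩
    0#                               ∎)

  InSpan-resp : ∀ {k n} (M : Fin k → Vec n) {u w : Vec n} → u ≋ w → InSpan M u → InSpan M w
  InSpan-resp M u≋w (a , u≋Ma) = a , λ j → trans (sym (u≋w j)) (u≋Ma j)

  InSpan-⊕ : ∀ {k n} (M : Fin k → Vec n) {u w : Vec n} → InSpan M u → InSpan M w → InSpan M (u ⊕ w)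
  InSpan-⊕ M (a , u≋Ma) (b , w≋Mb) =
    (λ i → a i + b i) , λ j → trans (+-cong (u≋Ma j) (w≋Mb j)) (sym (lin-+ M a b j))

  Coset-refl : ∀ {k} (P : Matrix k) x → Coset P x x
  Coset-refl P x = (λ _ → 0#) , λ j → sym (trans (+-congʳ (lin-zero P j)) (+-identityˡ (x j)))

  Coset-trans : ∀ {k} (P : Matrix k) {x v w} → Coset P x v → Coset P v w → Coset P x w
  Coset-trans P {x} {v} {w} (a , v≋Pa+x) (b , w≋Pb+v) = (λ i → b i + a i) , λ j → begin
    w j                            ≈⟨ w≋Pb+v j ⟩
    lin P b j + v j                ≈⟨ +-congˡ (v≋Pa+x j) ⟩
    lin P b j + (lin P a j + x j)  ≈⟨ +-assoc _ _ _ ⟨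
    (lin P b j + lin P a j) + x j  ≈⟨ +-congʳ (lin-+ P b a j) ⟨
    lin P (λ i → b i + a i) j + x j ∎

  Coset-sym : ∀ {k} (P : Matrix k) {x v} → Coset P x v → Coset P v x
  Coset-sym P {x} {v} (a , v≋Pa+x) = (λ i → - a i) , λ j → begin
    x j                                ≈⟨ \\-leftDividesʳ (lin P a j) (x j) ⟨
    - lin P a j + (lin P a j + x j)    ≈⟨ +-cong (lin-neg P a j) (v≋Pa+x j) ⟨
    lin P (λ i → - a i) j + v j        ∎

  infixr 5 _≐-trans_
  _≐-trans_ : ∀ {A B C : Subset} → A ≐ B → B ≐ C → A ≐ C
  (A≐B ≐-trans B≐C) v = proj₁ (B≐C v) ∘ proj₁ (A≐B v) , proj₂ (A≐B v) ∘ proj₂ (B≐C v)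

  ≐-sym : ∀ {A B : Subset} → A ≐ B → B ≐ A
  ≐-sym A≐B v = proj₂ (A≐B v) , proj₁ (A≐B v)

  ≐-refl : ∀ {A : Subset} → A ≐ A
  ≐-refl v = (λ h → h) , (λ h → h)

  Coset-≐ : ∀ {k} (P : Matrix k) {x v} → Coset P x v → Coset P x ≐ Coset P v
  Coset-≐ P v∈x+P w = Coset-trans P (Coset-sym P v∈x+P) , Coset-trans P v∈x+P

  cosets-meet⇒≐ : ∀ {k} (P : Matrix k) {x y v} {F G : Subset} →
    F ≐ Coset P x → G ≐ Coset P y → F v → G v → F ≐ G
  cosets-meet⇒≐ P {v = v} F≐x+P G≐y+P v∈F v∈G =
    F≐x+P ≐-trans Coset-≐ P (proj₁ (F≐x+P v) v∈F)
          ≐-trans ≐-sym (Coset-≐ P (proj₁ (G≐y+P v) v∈G)) ≐-trans ≐-sym G≐y+P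

  Coset⊆Span : ∀ {k m} {P : Matrix k} (Q : Matrix m) → P ⊆ₛ Q →
    ∀ {x v} → Span Q x → Coset P x v → Span Q v
  Coset⊆Span Q P⊆Q x∈Q (a , v≋Pa+x) =
    InSpan-resp Q (λ j → sym (v≋Pa+x j)) (InSpan-⊕ Q (P⊆Q _ (a , λ j → refl)) x∈Q)

  open Inverse enum using (to; from; from-cong; strictlyInverseˡ)

  ≈-dec : ∀ x y → Dec (x ≈ y)
  ≈-dec x y with from x ≟ from y
  ... | yes fx≡fy = yes (begin
    x           ≈⟨ strictlyInverseˡ x ⟨
    to (from x) ≡⟨ ≡.cong to fx≡fy ⟩
    to (from y) ≈⟨ strictlyInverseˡ y ⟩
    y           ∎)
  ... | no fx≢fy = no (fx≢fy ∘ from-cong)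

  ∃-dec : ∀ {p} {Pr : Carrier → Set p} → (∀ {x y} → x ≈ y → Pr x → Pr y) →
    (∀ x → Dec (Pr x)) → Dec (∃ Pr)
  ∃-dec resp Pr? = map′ (λ (i , p) → to i , p) (λ (x , p) → from x , resp (sym (strictlyInverseˡ x)) p)
                        (any? (Pr? ∘ to))

  -- Peeling off the first row: v = x M₀ + w with w in the span of the others.
  InSpan-dec : ∀ {k n} (M : Fin k → Vec n) v → Dec (InSpan M v)
  InSpan-dec {zero} M v = map′ (λ v≋0 → (λ ()) , v≋0) proj₂ (all? (λ j → ≈-dec (v j) 0#))
  InSpan-dec {suc k} M v = map′ extend restrict (∃-dec resp (λ x → InSpan-dec (tail M) (rest x)))
    where
    rest : Carrier → Vec _
    rest x j = - (x * M Fin.zero j) + v j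
    resp : ∀ {x y} → x ≈ y → InSpan (tail M) (rest x) → InSpan (tail M) (rest y)
    resp x≈y = InSpan-resp (tail M) (λ j → +-congʳ (-‿cong (*-congʳ x≈y)))
    extend : (∃ λ x → InSpan (tail M) (rest x)) → InSpan M v
    extend (x , a , rest≋Ma) = x ∷ a , λ j →
      trans (sym (\\-leftDividesˡ (x * M Fin.zero j) (v j))) (+-congˡ (rest≋Ma j))
    restrict : InSpan M v → ∃ λ x → InSpan (tail M) (rest x)
    restrict (a , v≋Ma) = a Fin.zero , tail a , λ j →
      sym (y≈x\\z (a Fin.zero * M Fin.zero j) _ (v j) (sym (v≋Ma j)))

  TypeI-isSpread : ∀ (P : Matrix ν) → MaxTI P → IsSpread (TypeI P)
  TypeI-isSpread P P-maxTI =
    (λ F (x , F≐x+P) → P , x , P-maxTI , F≐x+P) ,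
    (λ v → Coset P v , (v , ≐-refl) , Coset-refl P v) ,
    (λ F G v (x , F≐x+P) (y , G≐y+P) → cosets-meet⇒≐ P F≐x+P G≐y+P)

  TypeII-isSpread : ∀ (Q : Matrix (suc ν)) (P₁ P₂ : Matrix ν) →
    MaxTI P₁ → MaxTI P₂ → P₁ ⊆ₛ Q → P₂ ⊆ₛ Q → IsSpread (TypeII Q P₁ P₂)
  TypeII-isSpread Q P₁ P₂ P₁-maxTI P₂-maxTI P₁⊆Q P₂⊆Q = flats , cover , disjoint
    where
    flats : ∀ F → TypeII Q P₁ P₂ F → Flat-ν,0 F
    flats F (inj₁ (y , _ , F≐y+P₁)) = P₁ , y , P₁-maxTI , F≐y+P₁
    flats F (inj₂ (y , _ , F≐y+P₂)) = P₂ , y , P₂-maxTI , F≐y+P₂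

    cover : ∀ v → ∃ λ F → TypeII Q P₁ P₂ F × F v
    cover v with InSpan-dec Q v
    ... | yes v∈Q = Coset P₁ v , inj₁ (v , v∈Q , ≐-refl) , Coset-refl P₁ v
    ... | no  v∉Q = Coset P₂ v , inj₂ (v , v∉Q , ≐-refl) , Coset-refl P₂ v

    separated : ∀ {x y v} → Span Q x → ¬ Span Q y → Coset P₁ x v → ¬ Coset P₂ y v
    separated x∈Q y∉Q v∈x+P₁ v∈y+P₂ =
      y∉Q (Coset⊆Span Q P₂⊆Q (Coset⊆Span Q P₁⊆Q x∈Q v∈x+P₁) (Coset-sym P₂ v∈y+P₂))

    disjoint : ∀ F G v → TypeII Q P₁ P₂ F → TypeII Q P₁ P₂ G → F v → G v → F ≐ G
    disjoint F G v (inj₁ (_ , _ , F≐x+P₁)) (inj₁ (_ , _ , G≐y+P₁)) = cosets-meet⇒≐ P₁ F≐x+P₁ G≐y+P₁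
    disjoint F G v (inj₂ (_ , _ , F≐x+P₂)) (inj₂ (_ , _ , G≐y+P₂)) = cosets-meet⇒≐ P₂ F≐x+P₂ G≐y+P₂
    disjoint F G v (inj₁ (_ , x∈Q , F≐x+P₁)) (inj₂ (_ , y∉Q , G≐y+P₂)) v∈F v∈G =
      ⊥-elim (separated x∈Q y∉Q (proj₁ (F≐x+P₁ v) v∈F) (proj₁ (G≐y+P₂ v) v∈G))
    disjoint F G v (inj₂ (_ , x∉Q , F≐x+P₂)) (inj₁ (_ , y∈Q , G≐y+P₁)) v∈F v∈G =
      ⊥-elim (separated y∈Q x∉Q (proj₁ (G≐y+P₁ v) v∈G) (proj₁ (F≐x+P₂ v) v∈F))

-- The hypotheses 1 ≤ ν, ν ≥ 2, Q of type (ν+1,2) and P₁ ≠ P₂ make Type II a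
-- genuinely different spread, but the partition argument does not need them.
lemma4p1 : ∀ {c ℓ} (𝔽 : FiniteField c ℓ) (g : Geom (FiniteField.q 𝔽)) (ν : ℕ) → 1 ≤ ν →
    let open Geometry 𝔽 g ν in
    (∀ (P : Matrix ν) → MaxTI P → IsSpread (TypeI P))
    × (2 ≤ ν → ∀ (Q : Matrix (suc ν)) (P₁ P₂ : Matrix ν) →
        Type-ν+1,2 Q → MaxTI P₁ → MaxTI P₂ → P₁ ⊆ₛ Q → P₂ ⊆ₛ Q → ¬ (Span P₁ ≐ Span P₂) →
        IsSpread (TypeII Q P₁ P₂))
lemma4p1 𝔽 g ν _ =
  TypeI-isSpread 𝔽 g ν ,
  λ _ Q P₁ P₂ _ P₁-maxTI P₂-maxTI P₁⊆Q P₂⊆Q _ →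
    TypeII-isSpread 𝔽 g ν Q P₁ P₂ P₁-maxTI P₂-maxTI P₁⊆Q P₂⊆Q
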